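{- In the setting below, for all $a,b\in K$: $h(a\cdot b)=(h(a)\cdot h(b))^{\rhd\lhd}$; $h(a\backslash b)=h(a)\backslash h(b)$; $h(b/a)=h(b)/h(a)$; $h(a\wedge b)=h(a)\cap h(b)$; $h(a\vee b)=(h(a)\cup h(b))^{\rhd\lhd}$; $h(a^+)=\big(\bigcup_{n\ge1}h(a)^n\big)^{\rhd\lhd}$; $h(\top)=\Sigma^*$. Moreover, if $a\preceq b$ in $\mathcal K$ then $h(a)\subseteq h(b)$.
   Context: Let $\mathcal K=(K;\preceq,\cdot,\backslash,/,\wedge,\vee,\top,\bot,\mathbf 1)$ where $(K;\preceq,\wedge,\vee,\top,\bot)$ is a bounded lattice, $(K;\cdot,\mathbf 1)$ a monoid, $b\preceq a\backslash c\iff a\cdot b\preceq c\iff a\preceq c/b$, and $a^+=\sup\{a^n\mid n\ge1\}$ exists for all $a$ (an infinitary action lattice). Let $\overline\Sigma=\{\overline a\mid a\in K\}$, $\underline\Sigma=\{\underline b\mid b\in K\}$ be disjoint copies of $K$, $\Sigma=\overline\Sigma\cup\underline\Sigma$. For $x\in\Sigma^*$, $x^\bullet\in K$ is the product (in order) of the elements $a$ over all letters $\overline a$ of $x$ from $\overline\Sigma$, ignoring letters from $\underline\Sigma$ (empty product $=\mathbf 1$). Let $L=\{x\underline b\mid x\in\Sigma^*,b\in K,x^\bullet\preceq b\}\cup\{z\in\Sigma^*\mid z^\bullet=\bot\}$ and $h(b)=\{x\in\Sigma^*\mid x\underline b\in L\}$. For $M\subseteq\Sigma^*$, $M^{\rhd}=\{(x,y)\in\Sigma^*\times\Sigma^*\mid\forall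 w\in M\;xwy\in L\}$; for $C\subseteq\Sigma^*\times\Sigma^*$, $C^{\lhd}=\{v\in\Sigma^*\mid\forall(x,y)\in C\;xvy\in L\}$. $M_1\cdot M_2$ is concatenation, $M_1\backslash M_2=\{u\in\Sigma^*\mid\forall v\in M_1\;vu\in M_2\}$, $M_2/M_1=\{u\in\Sigma^*\mid\forall v\in M_1\;uv\in M_2\}$. -}

module Defs where

open import Level using (Level; _⊔_)
open import Data.Nat using (ℕ; zero; suc; _≥_)
open import Data.List using (List; []; _∷_; _++_; [_])
open import Data.Product using (Σ; _×_; _,_; ∃)
open import Data.Sum using (_⊎_)
open import Relation.Binary.PropositionalEquality using (_≡_)
open import Relation.Unary using (Pred)

mpow : ∀ {c} {K : Set c} → (K → K → K) → K → K → ℕ → K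
mpow _·_ e a zero    = e
mpow _·_ e a (suc n) = a · mpow _·_ e a n

record InfinitaryActionLattice (c ℓ : Level) : Set (Level.suc (c ⊔ ℓ)) where
  infixl 7 _·_
  infix  4 _⪯_
  field
    K    : Set c
    _⪯_  : K → K → Set ℓ
    ⪯-refl    : ∀ {a} → a ⪯ a
    ⪯-trans   : ∀ {a b d} → a ⪯ b → b ⪯ d → a ⪯ d
    ⪯-antisym : ∀ {a b} → a ⪯ b → b ⪯ a → a ≡ b
    _∧_ _∨_ : K → K → K
    ⊤ ⊥  : K
    ∧-lb₁ : ∀ a b → (a ∧ b) ⪯ a
    ∧-lb₂ : ∀ a b → (a ∧ b) ⪯ b
    ∧-glb : ∀ {a b d} → d ⪯ a → d ⪯ b → d ⪯ (a ∧ b)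
    ∨-ub₁ : ∀ a b → a ⪯ (a ∨ b)
    ∨-ub₂ : ∀ a b → b ⪯ (a ∨ b)
    ∨-lub : ∀ {a b d} → a ⪯ d → b ⪯ d → (a ∨ b) ⪯ d
    ⊤-max : ∀ a → a ⪯ ⊤
    ⊥-min : ∀ a → ⊥ ⪯ a
    _·_ : K → K → K
    𝟏   : K
    ·-assoc : ∀ a b d → (a · b) · d ≡ a · (b · d)
    ·-idˡ   : ∀ a → 𝟏 · a ≡ a
    ·-idʳ   : ∀ a → a · 𝟏 ≡ a
    _\\_ _//_ : K → K → K
    \\-res₁ : ∀ {a b d} → b ⪯ (a \\ d) → a · b ⪯ d
    \\-res₂ : ∀ {a b d} → a · b ⪯ d → b ⪯ (a \\ d)
    //-res₁ : ∀ {a b d} → a ⪯ (d // b) → a · b ⪯ d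
    //-res₂ : ∀ {a b d} → a · b ⪯ d → a ⪯ (d // b)
    _⁺ : K → K
    ⁺-ub  : ∀ a n → n ≥ 1 → mpow _·_ 𝟏 a n ⪯ a ⁺
    ⁺-lub : ∀ a d → (∀ n → n ≥ 1 → mpow _·_ 𝟏 a n ⪯ d) → a ⁺ ⪯ d

module Construction {c ℓ} (𝒦 : InfinitaryActionLattice c ℓ) where
  open InfinitaryActionLattice 𝒦

  -- the alphabet Σ = overline-Σ ∪ underline-Σ (disjoint copies of K)
  data Letter : Set c where
    over  : K → Letter
    under : K → Letter

  Word : Set c
  Word = List Letter

  _• : Word → K
  [] •              = 𝟏
  (over a ∷ x) •    = a · (x •)
  (under b ∷ x) •   = x •

  Lang : Set (Level.suc (c ⊔ ℓ))
  Lang = Pred Word (c ⊔ ℓ)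

  L : Lang
  L z = (Σ Word λ x → Σ K λ b → (z ≡ x ++ [ under b ]) × ((x •) ⪯ b)) ⊎ ((z •) ≡ ⊥)

  h : K → Lang
  h b x = L (x ++ [ under b ])

  _▷ : Lang → Pred (Word × Word) (c ⊔ ℓ)
  (M ▷) (x , y) = ∀ w → M w → L (x ++ w ++ y)

  _◁ : Pred (Word × Word) (c ⊔ ℓ) → Lang
  (C ◁) v = ∀ x y → C (x , y) → L (x ++ v ++ y)

  _⊙_ : Lang → Lang → Lang
  (M₁ ⊙ M₂) z = Σ Word λ u → Σ Word λ v → M₁ u × M₂ v × (z ≡ u ++ v)

  _\\ₗ_ : Lang → Lang → Lang
  (M₁ \\ₗ M₂) u = ∀ v → M₁ v → M₂ (v ++ u)

  _//ₗ_ : Lang → Lang → Lang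
  (M₂ //ₗ M₁) u = ∀ v → M₁ v → M₂ (u ++ v)

  lpow : Lang → ℕ → Lang
  lpow M zero w    = Level.Lift (c ⊔ ℓ) (w ≡ [])
  lpow M (suc n)   = M ⊙ lpow M n

  plusL : Lang → Lang
  plusL M w = ∃ λ n → n ≥ 1 × lpow M n w

{-# OPTIONS --safe #-}
module Submission where

open import Defs
open import Data.Product using (_×_; _,_)
open import Data.Sum using (inj₁; inj₂)
open import Relation.Unary using (_≐_; _⊆_; _∩_; _∪_; U)
open import Data.Nat using (zero; suc; s≤s; z≤n)
open import Data.List using (List; []; _∷_; _++_; [_]; _∷ʳ_; map; foldl; replicate; initLast; _∷ʳ′_)
open import Data.List.Properties using (foldl-++; ∷ʳ-injective)
open import Level using (lift)
open import Relation.Binary.Bundles using (Preorder)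
open import Relation.Binary.PropositionalEquality using (_≡_; refl; sym; trans; cong; isEquivalence)
import Relation.Binary.Reasoning.Preorder as PreorderReasoning

-- Write target z for b if z ends in an underlined letter b, and ⊥ otherwise. Then
-- L z holds iff z• ⪯ target z, so h b = {x | x• ⪯ b}. For a context (u , v) put
-- r = (u• \ target v) / v•: every x with x• ⪯ r has u x v ∈ L, and conversely
-- u x v ∈ L gives x• ⪯ r whenever x is a nonempty word of overlined letters, as
-- such an x does not change the target. Each closure (X ▷) ◁ is thus h of an
-- element c with X ⊆ h c that the overlined words of X force below every r:
-- c = a · b via a̅ b̅, c = a ∨ b via a̅ and b̅, and c = a⁺ via the words a̅ⁿ.

module Properties {c ℓ} (𝒦 : InfinitaryActionLattice c ℓ) where
  open InfinitaryActionLattice 𝒦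
  open Construction 𝒦

  ≡⇒⪯ : ∀ {a b} → a ≡ b → a ⪯ b
  ≡⇒⪯ refl = ⪯-refl

  ⪯-preorder : Preorder c c ℓ
  ⪯-preorder = record
    { Carrier    = K
    ; _≈_        = _≡_
    ; _≲_        = _⪯_
    ; isPreorder = record
      { isEquivalence = isEquivalence
      ; reflexive     = ≡⇒⪯
      ; trans         = ⪯-trans
      }
    }

  open PreorderReasoning ⪯-preorder

  ·-monoˡ-⪯ : ∀ {a b} d → a ⪯ b → a · d ⪯ b · d
  ·-monoˡ-⪯ d a⪯b = //-res₁ (⪯-trans a⪯b (//-res₂ ⪯-refl))

  ·-monoʳ-⪯ : ∀ {a b} d → a ⪯ b → d · a ⪯ d · b
  ·-monoʳ-⪯ d a⪯b = \\-res₁ (⪯-trans a⪯b (\\-res₂ ⪯-refl))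

  ·-mono-⪯ : ∀ {a b d e} → a ⪯ b → d ⪯ e → a · d ⪯ b · e
  ·-mono-⪯ {b = b} {d} a⪯b d⪯e = ⪯-trans (·-monoˡ-⪯ d a⪯b) (·-monoʳ-⪯ b d⪯e)

  •-++ : ∀ x y → (x ++ y) • ≡ x • · y •
  •-++ []            y = sym (·-idˡ (y •))
  •-++ (over a ∷ x)  y = trans (cong (a ·_) (•-++ x y)) (sym (·-assoc a (x •) (y •)))
  •-++ (under b ∷ x) y = •-++ x y

  •-∷ʳ-under : ∀ x b → (x ∷ʳ under b) • ≡ x •
  •-∷ʳ-under x b = trans (•-++ x [ under b ]) (·-idʳ (x •))

  h⇒•⪯ : ∀ {b x} → h b x → x • ⪯ b
  h⇒•⪯ {x = x} (inj₁ (x′ , b′ , eq , x′•⪯b′)) with refl , refl ← ∷ʳ-injective x x′ eq = x′•⪯b′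
  h⇒•⪯ {b} {x} (inj₂ x∷ʳb•≡⊥) = begin
    x •              ≡⟨ •-∷ʳ-under x b ⟨
    (x ∷ʳ under b) • ≡⟨ x∷ʳb•≡⊥ ⟩
    ⊥                ≲⟨ ⊥-min b ⟩
    b                ∎

  •⪯⇒h : ∀ {b x} → x • ⪯ b → h b x
  •⪯⇒h {b} {x} x•⪯b = inj₁ (x , b , refl , x•⪯b)

  h-mono : ∀ a b → a ⪯ b → h a ⊆ h b
  h-mono a b a⪯b x∈ha = •⪯⇒h (⪯-trans (h⇒•⪯ x∈ha) a⪯b)

  over∈h : ∀ a → h a [ over a ]
  over∈h a = •⪯⇒h {x = [ over a ]} (≡⇒⪯ (·-idʳ a))

  lastBound : K → Letter → K
  lastBound _ (over _)  = ⊥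
  lastBound _ (under b) = b

  target : Word → K
  target = foldl lastBound ⊥

  foldl-lastBound-mono : ∀ {t s} v → t ⪯ s → foldl lastBound t v ⪯ foldl lastBound s v
  foldl-lastBound-mono []            t⪯s = t⪯s
  foldl-lastBound-mono (over _ ∷ v)  _   = ⪯-refl
  foldl-lastBound-mono (under _ ∷ v) _   = ⪯-refl

  target-++ʳ : ∀ u v → target v ⪯ target (u ++ v)
  target-++ʳ u v = begin
    target v                     ≲⟨ foldl-lastBound-mono v (⊥-min (target u)) ⟩
    foldl lastBound (target u) v ≡⟨ foldl-++ lastBound ⊥ u v ⟨
    target (u ++ v)              ∎

  L⇒•⪯target : ∀ z → L z → z • ⪯ target z
  L⇒•⪯target z (inj₁ (x , b , refl , x•⪯b)) = begin
    (x ∷ʳ under b) •      ≡⟨ •-∷ʳ-under x b ⟩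
    x •                   ≲⟨ x•⪯b ⟩
    b                     ≡⟨ foldl-++ lastBound ⊥ x [ under b ] ⟨
    target (x ∷ʳ under b) ∎
  L⇒•⪯target z (inj₂ z•≡⊥) = ⪯-trans (≡⇒⪯ z•≡⊥) (⊥-min (target z))

  •⪯target⇒L : ∀ z → z • ⪯ target z → L z
  •⪯target⇒L z z•⪯t with initLast z
  ... | [] = inj₂ (⪯-antisym z•⪯t (⊥-min _))
  ... | x ∷ʳ′ over a =
    inj₂ (⪯-antisym (⪯-trans z•⪯t (≡⇒⪯ (foldl-++ lastBound ⊥ x [ over a ]))) (⊥-min _))
  ... | x ∷ʳ′ under b = inj₁ (x , b , refl , (begin
    x •                   ≡⟨ •-∷ʳ-under x b ⟨
    (x ∷ʳ under b) •      ≲⟨ z•⪯t ⟩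
    target (x ∷ʳ under b) ≡⟨ foldl-++ lastBound ⊥ x [ under b ] ⟩
    b                     ∎))

  overs : List K → Word
  overs = map over

  foldl-lastBound-overs : ∀ t a as v → foldl lastBound t (overs (a ∷ as) ++ v) ≡ target v
  foldl-lastBound-overs t a []        v = refl
  foldl-lastBound-overs t a (a′ ∷ as) v = foldl-lastBound-overs ⊥ a′ as v

  target-overs : ∀ u a as v → target (u ++ overs (a ∷ as) ++ v) ≡ target v
  target-overs u a as v =
    trans (foldl-++ lastBound ⊥ u (overs (a ∷ as) ++ v)) (foldl-lastBound-overs (target u) a as v)

  •-++-++ : ∀ u x v → (u ++ x ++ v) • ≡ u • · (x • · v •)
  •-++-++ u x v = trans (•-++ u (x ++ v)) (cong (u • ·_) (•-++ x v))

  residual : Word → Word → K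
  residual u v = ((u •) \\ target v) // (v •)

  •⪯residual⇒L : ∀ u x v → x • ⪯ residual u v → L (u ++ x ++ v)
  •⪯residual⇒L u x v x•⪯r = •⪯target⇒L (u ++ x ++ v) (begin
    (u ++ x ++ v) •      ≡⟨ •-++-++ u x v ⟩
    u • · (x • · v •)    ≲⟨ \\-res₁ (//-res₁ x•⪯r) ⟩
    target v             ≲⟨ target-++ʳ x v ⟩
    target (x ++ v)      ≲⟨ target-++ʳ u (x ++ v) ⟩
    target (u ++ x ++ v) ∎)

  ▷⇒overs•⪯residual : ∀ {X : Lang} u v a as → (X ▷) (u , v) → X (overs (a ∷ as)) →
                      overs (a ∷ as) • ⪯ residual u v
  ▷⇒overs•⪯residual u v a as uv∈X▷ w∈X = //-res₂ (\\-res₂ (begin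
    u • · (w • · v •)    ≡⟨ •-++-++ u w v ⟨
    (u ++ w ++ v) •      ≲⟨ L⇒•⪯target (u ++ w ++ v) (uv∈X▷ w w∈X) ⟩
    target (u ++ w ++ v) ≡⟨ target-overs u a as v ⟩
    target v             ∎))
    where w = overs (a ∷ as)

  h≐closure : ∀ {X : Lang} {b} → X ⊆ h b → (∀ u v → (X ▷) (u , v) → b ⪯ residual u v) →
              h b ≐ (X ▷) ◁
  h≐closure {b = b} X⊆hb bound =
      (λ {x} x∈hb u v uv∈X▷ → •⪯residual⇒L u x v (⪯-trans (h⇒•⪯ x∈hb) (bound u v uv∈X▷)))
    , (λ x∈closure → x∈closure [] [ under b ] (λ w w∈X → X⊆hb w∈X))

  h-· : ∀ a b → h (a · b) ≐ ((h a ⊙ h b) ▷) ◁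
  h-· a b = h≐closure product⊆h bound
    where
    product⊆h : h a ⊙ h b ⊆ h (a · b)
    product⊆h (u , v , u∈ha , v∈hb , refl) = •⪯⇒h (begin
      (u ++ v) •  ≡⟨ •-++ u v ⟩
      u • · v •   ≲⟨ ·-mono-⪯ (h⇒•⪯ u∈ha) (h⇒•⪯ v∈hb) ⟩
      a · b       ∎)

    bound : ∀ u v → ((h a ⊙ h b) ▷) (u , v) → a · b ⪯ residual u v
    bound u v uv∈ = begin
      a · b        ≡⟨ cong (a ·_) (·-idʳ b) ⟨
      a · (b · 𝟏)  ≲⟨ ▷⇒overs•⪯residual u v a [ b ] uv∈
                        ([ over a ] , [ over b ] , over∈h a , over∈h b , refl) ⟩
      residual u v ∎

  h-\\ : ∀ a b → h (a \\ b) ≐ (h a \\ₗ h b)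
  h-\\ a b =
      (λ {x} x∈h v v∈ha → •⪯⇒h (begin
        (v ++ x) • ≡⟨ •-++ v x ⟩
        v • · x •  ≲⟨ ·-monoˡ-⪯ (x •) (h⇒•⪯ v∈ha) ⟩
        a · x •    ≲⟨ \\-res₁ (h⇒•⪯ x∈h) ⟩
        b          ∎))
    , (λ {x} x∈res → •⪯⇒h (\\-res₂ (h⇒•⪯ {x = over a ∷ x} (x∈res [ over a ] (over∈h a)))))

  h-// : ∀ a b → h (b // a) ≐ (h b //ₗ h a)
  h-// a b =
      (λ {x} x∈h v v∈ha → •⪯⇒h (begin
        (x ++ v) • ≡⟨ •-++ x v ⟩
        x • · v •  ≲⟨ ·-monoʳ-⪯ (x •) (h⇒•⪯ v∈ha) ⟩
        x • · a    ≲⟨ //-res₁ (h⇒•⪯ x∈h) ⟩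
        b          ∎))
    , (λ {x} x∈res → •⪯⇒h (//-res₂ (begin
        x • · a              ≡⟨ cong (x • ·_) (·-idʳ a) ⟨
        x • · [ over a ] •   ≡⟨ •-++ x [ over a ] ⟨
        (x ++ [ over a ]) •  ≲⟨ h⇒•⪯ (x∈res [ over a ] (over∈h a)) ⟩
        b                    ∎)))

  h-∧ : ∀ a b → h (a ∧ b) ≐ (h a ∩ h b)
  h-∧ a b =
      (λ x∈h → h-mono (a ∧ b) a (∧-lb₁ a b) x∈h , h-mono (a ∧ b) b (∧-lb₂ a b) x∈h)
    , (λ { (x∈ha , x∈hb) → •⪯⇒h (∧-glb (h⇒•⪯ x∈ha) (h⇒•⪯ x∈hb)) })

  h-∨ : ∀ a b → h (a ∨ b) ≐ ((h a ∪ h b) ▷) ◁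
  h-∨ a b = h≐closure union⊆h bound
    where
    union⊆h : h a ∪ h b ⊆ h (a ∨ b)
    union⊆h (inj₁ x∈ha) = h-mono a (a ∨ b) (∨-ub₁ a b) x∈ha
    union⊆h (inj₂ x∈hb) = h-mono b (a ∨ b) (∨-ub₂ a b) x∈hb

    letter-bound : ∀ u v d → ((h a ∪ h b) ▷) (u , v) → (h a ∪ h b) [ over d ] → d ⪯ residual u v
    letter-bound u v d uv∈ d∈ = ⪯-trans (≡⇒⪯ (sym (·-idʳ d))) (▷⇒overs•⪯residual u v d [] uv∈ d∈)

    bound : ∀ u v → ((h a ∪ h b) ▷) (u , v) → a ∨ b ⪯ residual u v
    bound u v uv∈ =
      ∨-lub (letter-bound u v a uv∈ (inj₁ (over∈h a))) (letter-bound u v b uv∈ (inj₂ (over∈h b)))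

  overs-replicate-• : ∀ n a → overs (replicate n a) • ≡ mpow _·_ 𝟏 a n
  overs-replicate-• zero    a = refl
  overs-replicate-• (suc n) a = cong (a ·_) (overs-replicate-• n a)

  overs-replicate∈lpow : ∀ n a → lpow (h a) n (overs (replicate n a))
  overs-replicate∈lpow zero    a = lift refl
  overs-replicate∈lpow (suc n) a = [ over a ] , _ , over∈h a , overs-replicate∈lpow n a , refl

  lpow⇒•⪯mpow : ∀ n {a w} → lpow (h a) n w → w • ⪯ mpow _·_ 𝟏 a n
  lpow⇒•⪯mpow zero    (lift refl) = ⪯-refl
  lpow⇒•⪯mpow (suc n) (u , v , u∈ha , v∈hⁿ , refl) =
    ⪯-trans (≡⇒⪯ (•-++ u v)) (·-mono-⪯ (h⇒•⪯ u∈ha) (lpow⇒•⪯mpow n v∈hⁿ))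

  h-⁺ : ∀ a → h (a ⁺) ≐ (plusL (h a) ▷) ◁
  h-⁺ a = h≐closure plus⊆h bound
    where
    plus⊆h : plusL (h a) ⊆ h (a ⁺)
    plus⊆h (n , n≥1 , w∈hⁿ) = •⪯⇒h (⪯-trans (lpow⇒•⪯mpow n w∈hⁿ) (⁺-ub a n n≥1))

    bound : ∀ u v → (plusL (h a) ▷) (u , v) → a ⁺ ⪯ residual u v
    bound u v uv∈ = ⁺-lub a (residual u v) λ where
      (suc n) _ → begin
        mpow _·_ 𝟏 a (suc n)          ≡⟨ overs-replicate-• (suc n) a ⟨
        overs (replicate (suc n) a) • ≲⟨ ▷⇒overs•⪯residual u v a (replicate n a) uv∈
                                           (suc n , s≤s z≤n , overs-replicate∈lpow (suc n) a) ⟩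
        residual u v                  ∎

  h-⊤ : h ⊤ ≐ U
  h-⊤ = _ , λ _ → •⪯⇒h (⊤-max _)

lemma11 : ∀ {c ℓ} (𝒦 : InfinitaryActionLattice c ℓ) →
    let open InfinitaryActionLattice 𝒦 in let open Construction 𝒦 in
    (∀ a b →
        (h (a · b) ≐ ((h a ⊙ h b) ▷) ◁)
      × (h (a \\ b) ≐ (h a \\ₗ h b))
      × (h (b // a) ≐ (h b //ₗ h a))
      × (h (a ∧ b) ≐ (h a ∩ h b))
      × (h (a ∨ b) ≐ ((h a ∪ h b) ▷) ◁)
      × (h (a ⁺) ≐ (plusL (h a) ▷) ◁)
      × (h ⊤ ≐ U))
    × (∀ a b → a ⪯ b → h a ⊆ h b)
lemma11 𝒦 = (λ a b → h-· a b , h-\\ a b , h-// a b , h-∧ a b , h-∨ a b , h-⁺ a , h-⊤) , h-mono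
  where open Properties 𝒦
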